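{- Let $\mathcal{P}=(P,\leq)$ be a finite bounded poset with least element $\hat0$. The $m$-cover poset $\mathcal{P}^{\langle m\rangle}$ is a lattice for all integers $m>0$ if and only if $\mathcal{P}$ is a lattice and for all $p,q\in P$ we have $p\wedge q\in\{\hat{0},p,q\}$.
   Context: The $m$-cover poset $\mathcal{P}^{\langle m\rangle}$ is the subposet of the componentwise-ordered direct product $\mathcal{P}^m$ consisting of the multichains $x_1\le\cdots\le x_m$ of $\mathcal P$ such that $\{x_1,\dots,x_m\}\setminus\{\hat0\}$ is empty, a single element, or a two-element set $\{p,q\}$ with $p\lessdot q$ (a covering relation in $\mathcal P$). -}

module Defs where

open import Level using (0ℓ)
open import Data.Nat using (ℕ)
open import Data.Fin using (Fin) renaming (_≤_ to _≤ᶠ_)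
open import Data.Product using (Σ; ∃; _×_; _,_; proj₁)
open import Data.Sum using (_⊎_)
open import Relation.Nullary using (¬_)
open import Relation.Binary using (Rel; IsPartialOrder; Decidable)
open import Relation.Binary.PropositionalEquality using (_≡_; _≢_)

record FinBoundedPoset : Set₁ where
  field
    size           : ℕ
    _≤_            : Rel (Fin size) 0ℓ
    isPartialOrder : IsPartialOrder _≡_ _≤_
    _≤?_           : Decidable _≤_
    bot            : Fin size
    bot-least      : ∀ x → bot ≤ x
    top            : Fin size
    top-greatest   : ∀ x → x ≤ top

  Carrier : Set
  Carrier = Fin size

  _<_ : Rel Carrier 0ℓ
  x < y = x ≤ y × x ≢ y

  _⋖_ : Rel Carrier 0ℓ
  p ⋖ q = p < q × (∀ r → ¬ (p < r × r < q))

module _ {A : Set} (_≤_ : Rel A 0ℓ) where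

  IsJoin : A → A → A → Set
  IsJoin x y z = x ≤ z × y ≤ z × (∀ w → x ≤ w → y ≤ w → z ≤ w)

  IsMeet : A → A → A → Set
  IsMeet x y z = z ≤ x × z ≤ y × (∀ w → w ≤ x → w ≤ y → w ≤ z)

  IsLatticeRel : Set
  IsLatticeRel = ∀ x y → (∃ λ z → IsJoin x y z) × (∃ λ z → IsMeet x y z)

module _ (P : FinBoundedPoset) where
  open FinBoundedPoset P

  IsLatticeP : Set
  IsLatticeP = IsLatticeRel _≤_

  IsMultichain : (m : ℕ) → (Fin m → Carrier) → Set
  IsMultichain m x = ∀ i j → i ≤ᶠ j → x i ≤ x j

  -- {x₁,…,xₘ} ∖ {0̂} is empty, a singleton, or {p,q} with p ⋖ q
  CoverCondition : (m : ℕ) → (Fin m → Carrier) → Set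
  CoverCondition m x =
      (∀ i → x i ≡ bot)
    ⊎ (Σ Carrier λ p → p ≢ bot × (∀ i → x i ≡ bot ⊎ x i ≡ p) × (∃ λ i → x i ≡ p))
    ⊎ (Σ Carrier λ p → Σ Carrier λ q → p ⋖ q × p ≢ bot × q ≢ bot
         × (∀ i → x i ≡ bot ⊎ x i ≡ p ⊎ x i ≡ q)
         × (∃ λ i → x i ≡ p) × (∃ λ j → x j ≡ q))

  MCover : ℕ → Set
  MCover m = Σ (Fin m → Carrier) λ x → IsMultichain m x × CoverCondition m x

  _≤ᴹ_ : ∀ {m} → Rel (MCover m) 0ℓ
  x ≤ᴹ y = ∀ i → proj₁ x i ≤ proj₁ y i

  MCoverIsLattice : ℕ → Set
  MCoverIsLattice m = IsLatticeRel (_≤ᴹ_ {m})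

-- Write a ⊑ b when a = 0̂, a = b or a ⋖ b. A multichain x₁ ≤ ⋯ ≤ xₘ lies in
-- P^⟨m⟩ exactly when xᵢ ⊑ xₘ for every i.
--
-- If P^⟨m⟩ is always a lattice, then P ≅ P^⟨1⟩ is one. If some p ∧ q = r were
-- not in {0̂, p, q}, pick covers r ⋖ p' ≤ p and r ⋖ q' ≤ q; they are
-- incomparable, so J = p' ∨ q' lies strictly above both. The join of (r, p')
-- and (r, q') in P^⟨2⟩ is then some (a, J) with a ⋖ J and a below every s ⋖ J
-- lying over p' or over q', so p' ∨ q' ≤ a < J.
--
-- Conversely, when meets are trivial the elements above any a ≠ 0̂ form a
-- chain, and the componentwise meet is already in P^⟨m⟩. The componentwise
-- join z has last entry t, and its entries outside {0̂, t} lie below a single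
-- c ⋖ t; rounding them up to c gives the join, since every upper bound v with
-- vᵢ ⋖ vₘ has vᵢ comparable to c and hence vᵢ ≥ c.
module Submission where

open import Defs
open import Data.Nat using (ℕ; _>_; zero; suc; s≤s; z≤n)
open import Data.Fin using (Fin; fromℕ) renaming (zero to fzero; suc to fsuc; _≤_ to _≤ᶠ_)
open import Data.Fin.Properties using (any?; ≤fromℕ) renaming (≤-total to ≤ᶠ-total; _≟_ to _≟ᶠ_)
open import Data.Fin.Induction using (po-wellFounded; po-noetherian)
open import Data.Product using (_×_; _,_; proj₁; proj₂; ∃)
open import Data.Sum using (_⊎_; inj₁; inj₂)
open import Data.Empty using (⊥; ⊥-elim)
open import Function.Base using (flip)
open import Function.Bundles using (_⇔_; mk⇔)
open import Induction.WellFounded using (Acc; acc)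
open import Relation.Nullary using (¬_; Dec; yes; no)
open import Relation.Nullary.Decidable using (_×-dec_; ¬?)
open import Relation.Binary using (IsPartialOrder)
open import Relation.Binary.PropositionalEquality using (_≡_; refl; sym; trans; subst; _≢_)
import Relation.Binary.Construct.NonStrictToStrict as ToStrict

module _ (P : FinBoundedPoset) where
  open FinBoundedPoset P
  open IsPartialOrder isPartialOrder using (antisym; ≤-respʳ-≈)
    renaming (refl to ≤-refl; reflexive to ≤-reflexive; trans to ≤-trans)

  _≟_ : (a b : Carrier) → Dec (a ≡ b)
  _≟_ = _≟ᶠ_

  _<?_ : (a b : Carrier) → Dec (a < b)
  a <? b = (a ≤? b) ×-dec ¬? (a ≟ b)

  <⇒≱ : ∀ {a b} → a < b → ¬ b ≤ a
  <⇒≱ = ToStrict.<⇒≱ _≡_ _≤_ antisym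

  <-≤-trans : ∀ {a b c} → a < b → b ≤ c → a < c
  <-≤-trans = ToStrict.<-≤-trans _≡_ _≤_ sym ≤-trans antisym ≤-respʳ-≈

  ≤-≡bot : ∀ {a b} → a ≤ b → b ≡ bot → a ≡ bot
  ≤-≡bot a≤b refl = antisym a≤b (bot-least _)

  ⋖-unique : ∀ {a b c} → a ⋖ b → a ≤ c → c < b → a ≡ c
  ⋖-unique {a} {c = c} (_ , nothing-between) a≤c c<b with a ≟ c
  ... | yes a≡c = a≡c
  ... | no a≢c = ⊥-elim (nothing-between c ((a≤c , a≢c) , c<b))

  cover-above : ∀ {x y} → x < y → ∃ λ c → x ⋖ c × c ≤ y
  cover-above {x} {y} = go (po-wellFounded isPartialOrder y)
    where
    go : ∀ {y} → Acc _<_ y → x < y → ∃ λ c → x ⋖ c × c ≤ y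
    go {y} (acc below) x<y with any? (λ r → (x <? r) ×-dec (r <? y))
    ... | yes (r , x<r , r<y) =
      let c , x⋖c , c≤r = go (below r<y) x<r in c , x⋖c , ≤-trans c≤r (proj₁ r<y)
    ... | no ∄r = y , (x<y , λ r x<r<y → ∄r (r , x<r<y)) , ≤-refl

  cover-below : ∀ {x y} → x < y → ∃ λ c → x ≤ c × c ⋖ y
  cover-below {x} {y} = go (po-noetherian isPartialOrder x)
    where
    go : ∀ {x} → Acc (flip _<_) x → x < y → ∃ λ c → x ≤ c × c ⋖ y
    go {x} (acc above) x<y with any? (λ r → (x <? r) ×-dec (r <? y))
    ... | yes (r , x<r , r<y) =
      let c , r≤c , c⋖y = go (above x<r) r<y in c , ≤-trans (proj₁ x<r) r≤c , c⋖y
    ... | no ∄r = x , ≤-refl , (x<y , λ r x<r<y → ∄r (r , x<r<y))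

  _⊑_ : Carrier → Carrier → Set
  a ⊑ b = a ≡ bot ⊎ a ≡ b ⊎ a ⋖ b

  ⊑⇒≤ : ∀ {a b} → a ⊑ b → a ≤ b
  ⊑⇒≤ (inj₁ refl) = bot-least _
  ⊑⇒≤ (inj₂ (inj₁ refl)) = ≤-refl
  ⊑⇒≤ (inj₂ (inj₂ a⋖b)) = proj₁ (proj₁ a⋖b)

  ⊑-between : ∀ {a e b} → a ≤ e → e ≤ b → a ⊑ b → a ⊑ e
  ⊑-between _ _ (inj₁ a≡bot) = inj₁ a≡bot
  ⊑-between a≤e e≤b (inj₂ (inj₁ refl)) = inj₂ (inj₁ (antisym a≤e e≤b))
  ⊑-between {e = e} {b} a≤e e≤b (inj₂ (inj₂ a⋖b)) with e ≟ b
  ... | yes refl = inj₂ (inj₂ a⋖b)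
  ... | no e≢b = inj₂ (inj₁ (⋖-unique a⋖b a≤e (e≤b , e≢b)))

  Inner : Carrier → Carrier → Set
  Inner t a = a ≢ bot × a ≢ t

  inner? : ∀ t a → Dec (Inner t a)
  inner? t a = ¬? (a ≟ bot) ×-dec ¬? (a ≟ t)

  classify : ∀ t a → a ≡ bot ⊎ a ≡ t ⊎ Inner t a
  classify t a with a ≟ bot | a ≟ t
  ... | yes a≡bot | _ = inj₁ a≡bot
  ... | no _ | yes a≡t = inj₂ (inj₁ a≡t)
  ... | no a≢bot | no a≢t = inj₂ (inj₂ (a≢bot , a≢t))

  coverCondition⇒⊑ : ∀ {m x} → IsMultichain P m x → CoverCondition P m x →
                     ∀ i j → i ≤ᶠ j → x i ⊑ x j
  coverCondition⇒⊑ _ (inj₁ all-bot) i _ _ = inj₁ (all-bot i)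
  coverCondition⇒⊑ chain (inj₂ (inj₁ (_ , _ , values , _))) i j i≤j
    with values i | values j
  ... | inj₁ xi≡bot | _ = inj₁ xi≡bot
  ... | inj₂ _ | inj₁ xj≡bot = inj₁ (≤-≡bot (chain i j i≤j) xj≡bot)
  ... | inj₂ xi≡p | inj₂ xj≡p = inj₂ (inj₁ (trans xi≡p (sym xj≡p)))
  coverCondition⇒⊑ chain (inj₂ (inj₂ (_ , _ , p⋖q , _ , _ , values , _))) i j i≤j
    with values i | values j
  ... | inj₁ xi≡bot | _ = inj₁ xi≡bot
  ... | inj₂ _ | inj₁ xj≡bot = inj₁ (≤-≡bot (chain i j i≤j) xj≡bot)
  ... | inj₂ (inj₁ xi≡p) | inj₂ (inj₁ xj≡p) = inj₂ (inj₁ (trans xi≡p (sym xj≡p)))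
  ... | inj₂ (inj₂ xi≡q) | inj₂ (inj₂ xj≡q) = inj₂ (inj₁ (trans xi≡q (sym xj≡q)))
  ... | inj₂ (inj₁ refl) | inj₂ (inj₂ refl) = inj₂ (inj₂ p⋖q)
  ... | inj₂ (inj₂ refl) | inj₂ (inj₁ refl) = ⊥-elim (<⇒≱ (proj₁ p⋖q) (chain i j i≤j))

  ⊑last⇒coverCondition : ∀ {k x} → IsMultichain P (suc k) x → (∀ i → x i ⊑ x (fromℕ k)) →
                        CoverCondition P (suc k) x
  ⊑last⇒coverCondition {k} {x} chain ⊑last
    with x (fromℕ k) ≟ bot | any? (λ i → inner? (x (fromℕ k)) (x i))
  ... | yes last≡bot | _ = inj₁ λ i → ≤-≡bot (chain i (fromℕ k) (≤fromℕ i)) last≡bot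
  ... | no last≢bot | no ∄inner = inj₂ (inj₁ (x (fromℕ k) , last≢bot , values , fromℕ k , refl))
    where
    values : ∀ i → x i ≡ bot ⊎ x i ≡ x (fromℕ k)
    values i with classify (x (fromℕ k)) (x i)
    ... | inj₁ xi≡bot = inj₁ xi≡bot
    ... | inj₂ (inj₁ xi≡last) = inj₂ xi≡last
    ... | inj₂ (inj₂ inner) = ⊥-elim (∄inner (i , inner))
  ... | no last≢bot | yes (i₀ , inner₀) =
    inj₂ (inj₂ (x i₀ , x (fromℕ k) , ⋖last inner₀ , proj₁ inner₀ , last≢bot , values ,
                (i₀ , refl) , (fromℕ k , refl)))
    where
    ⋖last : ∀ {i} → Inner (x (fromℕ k)) (x i) → x i ⋖ x (fromℕ k)
    ⋖last {i} (xi≢bot , xi≢last) with ⊑last i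
    ... | inj₁ xi≡bot = ⊥-elim (xi≢bot xi≡bot)
    ... | inj₂ (inj₁ xi≡last) = ⊥-elim (xi≢last xi≡last)
    ... | inj₂ (inj₂ xi⋖last) = xi⋖last

    values : ∀ j → x j ≡ bot ⊎ x j ≡ x i₀ ⊎ x j ≡ x (fromℕ k)
    values j with classify (x (fromℕ k)) (x j)
    ... | inj₁ xj≡bot = inj₁ xj≡bot
    ... | inj₂ (inj₁ xj≡last) = inj₂ (inj₂ xj≡last)
    ... | inj₂ (inj₂ inner) with ≤ᶠ-total i₀ j
    ...   | inj₁ i₀≤j = inj₂ (inj₁ (sym (⋖-unique (⋖last inner₀) (chain i₀ j i₀≤j) (proj₁ (⋖last inner)))))
    ...   | inj₂ j≤i₀ = inj₂ (inj₁ (⋖-unique (⋖last inner) (chain j i₀ j≤i₀) (proj₁ (⋖last inner₀))))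

  mcover : ∀ {k} (x : Fin (suc k) → Carrier) → IsMultichain P (suc k) x →
           (∀ i → x i ⊑ x (fromℕ k)) → MCover P (suc k)
  mcover x chain ⊑last = x , chain , ⊑last⇒coverCondition chain ⊑last

  mcover-⊑ : ∀ {m} (X : MCover P m) → ∀ i j → i ≤ᶠ j → proj₁ X i ⊑ proj₁ X j
  mcover-⊑ (_ , chain , cover) = coverCondition⇒⊑ chain cover

  constant : ∀ k → Carrier → MCover P (suc k)
  constant k a = mcover (λ _ → a) (λ _ _ _ → ≤-refl) (λ _ → inj₂ (inj₁ refl))

  entries : Carrier → Carrier → Fin 2 → Carrier
  entries a b fzero = a
  entries a b (fsuc _) = b

  pair : ∀ {a b} → a ⊑ b → MCover P 2
  pair {a} {b} a⊑b = mcover (entries a b) chain ⊑last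
    where
    chain : IsMultichain P 2 (entries a b)
    chain fzero fzero _ = ≤-refl
    chain fzero (fsuc fzero) _ = ⊑⇒≤ a⊑b
    chain (fsuc fzero) (fsuc fzero) _ = ≤-refl

    ⊑last : ∀ i → entries a b i ⊑ b
    ⊑last fzero = a⊑b
    ⊑last (fsuc fzero) = inj₂ (inj₁ refl)

  entries-≤ : ∀ {a b c d} → a ≤ c → b ≤ d → ∀ i → entries a b i ≤ entries c d i
  entries-≤ a≤c _ fzero = a≤c
  entries-≤ _ b≤d (fsuc _) = b≤d

  MeetsTrivial : Set
  MeetsTrivial = ∀ p q r → IsMeet _≤_ p q r → r ≡ bot ⊎ r ≡ p ⊎ r ≡ q

  module LatticeOps (L : IsLatticeP P) where
    infix 30 _∨_ _∧_

    _∨_ : Carrier → Carrier → Carrier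
    a ∨ b = proj₁ (proj₁ (L a b))

    x≤x∨y : ∀ {a b} → a ≤ a ∨ b
    x≤x∨y {a} {b} = proj₁ (proj₂ (proj₁ (L a b)))

    y≤x∨y : ∀ {a b} → b ≤ a ∨ b
    y≤x∨y {a} {b} = proj₁ (proj₂ (proj₂ (proj₁ (L a b))))

    ∨-least : ∀ {a b c} → a ≤ c → b ≤ c → a ∨ b ≤ c
    ∨-least {a} {b} {c} = proj₂ (proj₂ (proj₂ (proj₁ (L a b)))) c

    _∧_ : Carrier → Carrier → Carrier
    a ∧ b = proj₁ (proj₂ (L a b))

    ∧-isMeet : ∀ a b → IsMeet _≤_ a b (a ∧ b)
    ∧-isMeet a b = proj₂ (proj₂ (L a b))

    x∧y≤x : ∀ {a b} → a ∧ b ≤ a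
    x∧y≤x {a} {b} = proj₁ (∧-isMeet a b)

    x∧y≤y : ∀ {a b} → a ∧ b ≤ b
    x∧y≤y {a} {b} = proj₁ (proj₂ (∧-isMeet a b))

    ∧-greatest : ∀ {a b c} → c ≤ a → c ≤ b → c ≤ a ∧ b
    ∧-greatest {a} {b} {c} = proj₂ (proj₂ (∧-isMeet a b)) c

  lattice-of-1-cover : MCoverIsLattice P 1 → IsLatticeP P
  lattice-of-1-cover H a b with H (constant 0 a) (constant 0 b)
  ... | (J , a≤J , b≤J , J-least) , (M , M≤a , M≤b , M-greatest) =
      (proj₁ J fzero , a≤J fzero , b≤J fzero ,
       λ c a≤c b≤c → J-least (constant 0 c) (λ _ → a≤c) (λ _ → b≤c) fzero)
    , (proj₁ M fzero , M≤a fzero , M≤b fzero ,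
       λ c c≤a c≤b → M-greatest (constant 0 c) (λ _ → c≤a) (λ _ → c≤b) fzero)

  module _ (L : IsLatticeP P) where
    open LatticeOps L

    incomparable-covers-have-no-join :
      ∀ {r p q} (r⋖p : r ⋖ p) (r⋖q : r ⋖ q) → r ≢ bot → ¬ p ≤ q → ¬ q ≤ p →
      ¬ ∃ (IsJoin (_≤ᴹ_ P) (pair (inj₂ (inj₂ r⋖p))) (pair (inj₂ (inj₂ r⋖q))))
    incomparable-covers-have-no-join {r} {p} {q} r⋖p r⋖q r≢bot p≰q q≰p
      ((W , W-chain , W-cover) , X≤W , Y≤W , W-least)
      with cover-below {p} {p ∨ q} (x≤x∨y , λ p≡J → q≰p (subst (q ≤_) (sym p≡J) y≤x∨y))
         | cover-below {q} {p ∨ q} (y≤x∨y , λ q≡J → p≰q (subst (p ≤_) (sym q≡J) x≤x∨y))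
    ... | s , p≤s , s⋖J | s' , q≤s' , s'⋖J =
      impossible (coverCondition⇒⊑ W-chain W-cover fzero (fsuc fzero) z≤n)
      where
      r≤p : r ≤ p
      r≤p = proj₁ (proj₁ r⋖p)

      r≤q : r ≤ q
      r≤q = proj₁ (proj₁ r⋖q)

      W₁≡J : W (fsuc fzero) ≡ p ∨ q
      W₁≡J = antisym
        (W-least (pair {p ∨ q} (inj₂ (inj₁ refl)))
                 (entries-≤ (≤-trans r≤p x≤x∨y) x≤x∨y) (entries-≤ (≤-trans r≤p x≤x∨y) y≤x∨y)
                 (fsuc fzero))
        (∨-least (X≤W (fsuc fzero)) (Y≤W (fsuc fzero)))

      W₀≤s : W fzero ≤ s
      W₀≤s = W-least (pair (inj₂ (inj₂ s⋖J)))
                     (entries-≤ (≤-trans r≤p p≤s) x≤x∨y) (entries-≤ (≤-trans r≤p p≤s) y≤x∨y)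
                     fzero

      W₀≤s' : W fzero ≤ s'
      W₀≤s' = W-least (pair (inj₂ (inj₂ s'⋖J)))
                      (entries-≤ (≤-trans r≤q q≤s') x≤x∨y) (entries-≤ (≤-trans r≤q q≤s') y≤x∨y)
                      fzero

      impossible : W fzero ⊑ W (fsuc fzero) → ⊥
      impossible (inj₁ W₀≡bot) = r≢bot (≤-≡bot (X≤W fzero) W₀≡bot)
      impossible (inj₂ (inj₁ W₀≡W₁)) = <⇒≱ (proj₁ s⋖J) (subst (_≤ s) (trans W₀≡W₁ W₁≡J) W₀≤s)
      impossible (inj₂ (inj₂ W₀⋖W₁)) = <⇒≱ (proj₁ s⋖J) (∨-least p≤s (subst (q ≤_) (sym s≡s') q≤s'))
        where
        W₀⋖J : W fzero ⋖ p ∨ q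
        W₀⋖J = subst (W fzero ⋖_) W₁≡J W₀⋖W₁

        s≡s' : s ≡ s'
        s≡s' = trans (sym (⋖-unique W₀⋖J W₀≤s (proj₁ s⋖J))) (⋖-unique W₀⋖J W₀≤s' (proj₁ s'⋖J))

    meets-trivial : MCoverIsLattice P 2 → MeetsTrivial
    meets-trivial H p q r (r≤p , r≤q , r-greatest) with r ≟ bot | r ≟ p | r ≟ q
    ... | yes r≡bot | _ | _ = inj₁ r≡bot
    ... | no _ | yes r≡p | _ = inj₂ (inj₁ r≡p)
    ... | no _ | no _ | yes r≡q = inj₂ (inj₂ r≡q)
    ... | no r≢bot | no r≢p | no r≢q
      with cover-above (r≤p , r≢p) | cover-above (r≤q , r≢q)
    ... | p' , r⋖p' , p'≤p | q' , r⋖q' , q'≤q =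
      ⊥-elim (incomparable-covers-have-no-join r⋖p' r⋖q' r≢bot
                (λ p'≤q' → not-below r⋖p' p'≤p (≤-trans p'≤q' q'≤q))
                (λ q'≤p' → not-below r⋖q' (≤-trans q'≤p' p'≤p) q'≤q)
                (proj₁ (H (pair (inj₂ (inj₂ r⋖p'))) (pair (inj₂ (inj₂ r⋖q'))))))
      where
      not-below : ∀ {a} → r ⋖ a → a ≤ p → a ≤ q → ⊥
      not-below r⋖a a≤p a≤q = <⇒≱ (proj₁ r⋖a) (r-greatest _ a≤p a≤q)

  module Collapse (t c : Carrier) where
    collapse : Carrier → Carrier
    collapse a with classify t a
    ... | inj₁ _ = bot
    ... | inj₂ (inj₁ _) = t
    ... | inj₂ (inj₂ _) = c

    collapse-t : collapse t ≡ t
    collapse-t with classify t t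
    ... | inj₁ t≡bot = sym t≡bot
    ... | inj₂ (inj₁ _) = refl
    ... | inj₂ (inj₂ (_ , t≢t)) = ⊥-elim (t≢t refl)

    collapse-⊑ : c ⊑ t → ∀ a → collapse a ⊑ t
    collapse-⊑ c⊑t a with classify t a
    ... | inj₁ _ = inj₁ refl
    ... | inj₂ (inj₁ _) = inj₂ (inj₁ refl)
    ... | inj₂ (inj₂ _) = c⊑t

    collapse-mono : c ≤ t → ∀ {a b} → a ≤ b → b ≤ t → collapse a ≤ collapse b
    collapse-mono c≤t {a} {b} a≤b b≤t with classify t a | classify t b
    ... | inj₁ _ | _ = bot-least _
    ... | inj₂ (inj₁ a≡t) | inj₁ b≡bot = ≤-reflexive (trans (sym a≡t) (≤-≡bot a≤b b≡bot))
    ... | inj₂ (inj₁ _) | inj₂ (inj₁ _) = ≤-refl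
    ... | inj₂ (inj₁ refl) | inj₂ (inj₂ (_ , b≢t)) = ⊥-elim (b≢t (antisym b≤t a≤b))
    ... | inj₂ (inj₂ (a≢bot , _)) | inj₁ b≡bot = ⊥-elim (a≢bot (≤-≡bot a≤b b≡bot))
    ... | inj₂ (inj₂ _) | inj₂ (inj₁ _) = c≤t
    ... | inj₂ (inj₂ _) | inj₂ (inj₂ _) = ≤-refl

    ≤-collapse : ∀ {a} → (Inner t a → a ≤ c) → a ≤ collapse a
    ≤-collapse {a} inner⇒≤c with classify t a
    ... | inj₁ a≡bot = ≤-reflexive a≡bot
    ... | inj₂ (inj₁ a≡t) = ≤-reflexive a≡t
    ... | inj₂ (inj₂ inner) = inner⇒≤c inner

    collapse-least : ∀ {a u} → a ≤ u → (Inner t a → c ≤ u) → collapse a ≤ u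
    collapse-least {a} a≤u inner⇒c≤u with classify t a
    ... | inj₁ _ = bot-least _
    ... | inj₂ (inj₁ refl) = a≤u
    ... | inj₂ (inj₂ inner) = inner⇒c≤u inner

  module _ (L : IsLatticeP P) (T : MeetsTrivial) where
    open LatticeOps L

    ∧-trivial : ∀ a b → a ∧ b ≡ bot ⊎ a ∧ b ≡ a ⊎ a ∧ b ≡ b
    ∧-trivial a b = T a b (a ∧ b) (∧-isMeet a b)

    comparable-above-nonbot : ∀ {a u v} → a ≢ bot → a ≤ u → a ≤ v → u ≤ v ⊎ v ≤ u
    comparable-above-nonbot {a} {u} {v} a≢bot a≤u a≤v with ∧-trivial u v
    ... | inj₁ u∧v≡bot = ⊥-elim (a≢bot (≤-≡bot (∧-greatest a≤u a≤v) u∧v≡bot))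
    ... | inj₂ (inj₁ u∧v≡u) = inj₁ (subst (_≤ v) u∧v≡u x∧y≤y)
    ... | inj₂ (inj₂ u∧v≡v) = inj₂ (subst (_≤ u) u∧v≡v x∧y≤x)

    module _ {k} (X Y : MCover P (suc k)) where
      private
        last : Fin (suc k)
        last = fromℕ k

        x y : Fin (suc k) → Carrier
        x = proj₁ X
        y = proj₁ Y

      meet : ∃ (IsMeet (_≤ᴹ_ P) X Y)
      meet = mcover u chain ⊑last , (λ _ → x∧y≤x) , (λ _ → x∧y≤y) ,
             λ V V≤X V≤Y i → ∧-greatest (V≤X i) (V≤Y i)
        where
        u : Fin (suc k) → Carrier
        u i = x i ∧ y i

        chain : IsMultichain P (suc k) u
        chain i j i≤j = ∧-greatest (≤-trans x∧y≤x (proj₁ (proj₂ X) i j i≤j))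
                                   (≤-trans x∧y≤y (proj₁ (proj₂ Y) i j i≤j))

        ⊑last : ∀ i → u i ⊑ u last
        ⊑last i with ∧-trivial (x i) (y i)
        ... | inj₁ ui≡bot = inj₁ ui≡bot
        ... | inj₂ (inj₁ ui≡xi) = ⊑-between (chain i last (≤fromℕ i)) x∧y≤x
            (subst (_⊑ x last) (sym ui≡xi) (mcover-⊑ X i last (≤fromℕ i)))
        ... | inj₂ (inj₂ ui≡yi) = ⊑-between (chain i last (≤fromℕ i)) x∧y≤y
            (subst (_⊑ y last) (sym ui≡yi) (mcover-⊑ Y i last (≤fromℕ i)))

      private
        z : Fin (suc k) → Carrier
        z i = x i ∨ y i

        t : Carrier
        t = z last

        z-chain : IsMultichain P (suc k) z
        z-chain i j i≤j = ∨-least (≤-trans (proj₁ (proj₂ X) i j i≤j) x≤x∨y)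
                                  (≤-trans (proj₁ (proj₂ Y) i j i≤j) y≤x∨y)

        z-least : ∀ V → _≤ᴹ_ P X V → _≤ᴹ_ P Y V → ∀ i → z i ≤ proj₁ V i
        z-least V X≤V Y≤V i = ∨-least (X≤V i) (Y≤V i)

        RoundingTarget : Carrier → Set
        RoundingTarget c = c ⊑ t × (∀ i → Inner t (z i) → z i ≤ c)
          × (∀ V → _≤ᴹ_ P X V → _≤ᴹ_ P Y V → ∀ i → Inner t (z i) → c ≤ proj₁ V i)

        rounding-target : ∃ RoundingTarget
        rounding-target with any? (λ i → inner? t (z i))
        ... | no ∄inner = t , inj₂ (inj₁ refl) , (λ i inner → ⊥-elim (∄inner (i , inner))) ,
                          (λ _ _ _ i inner → ⊥-elim (∄inner (i , inner)))
        ... | yes (i₀ , zi₀≢bot , zi₀≢t) with cover-below (z-chain i₀ last (≤fromℕ i₀) , zi₀≢t)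
        ...   | c , zi₀≤c , c⋖t = c , inj₂ (inj₂ c⋖t) , inner≤c , c≤upper
          where
          inner≤c : ∀ i → Inner t (z i) → z i ≤ c
          inner≤c i (_ , zi≢t) with ≤ᶠ-total i i₀
          ... | inj₁ i≤i₀ = ≤-trans (z-chain i i₀ i≤i₀) zi₀≤c
          ... | inj₂ i₀≤i with comparable-above-nonbot zi₀≢bot zi₀≤c (z-chain i₀ i i₀≤i)
          ...   | inj₁ c≤zi = ≤-reflexive (sym (⋖-unique c⋖t c≤zi (z-chain i last (≤fromℕ i) , zi≢t)))
          ...   | inj₂ zi≤c = zi≤c

          c≤upper : ∀ V → _≤ᴹ_ P X V → _≤ᴹ_ P Y V → ∀ i → Inner t (z i) → c ≤ proj₁ V i
          c≤upper V X≤V Y≤V i inner@(zi≢bot , _) with mcover-⊑ V i last (≤fromℕ i)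
          ... | inj₁ vi≡bot = ⊥-elim (zi≢bot (≤-≡bot (z-least V X≤V Y≤V i) vi≡bot))
          ... | inj₂ (inj₁ vi≡vlast) =
            ≤-trans (proj₁ (proj₁ c⋖t)) (subst (t ≤_) (sym vi≡vlast) (z-least V X≤V Y≤V last))
          ... | inj₂ (inj₂ vi⋖vlast)
            with comparable-above-nonbot zi≢bot (inner≤c i inner) (z-least V X≤V Y≤V i)
          ...   | inj₁ c≤vi = c≤vi
          ...   | inj₂ vi≤c = ≤-reflexive (sym (⋖-unique vi⋖vlast vi≤c
                                                  (<-≤-trans (proj₁ c⋖t) (z-least V X≤V Y≤V last))))

      join : ∃ (IsJoin (_≤ᴹ_ P) X Y)
      join with rounding-target
      ... | c , c⊑t , inner≤c , c≤upper =
        mcover w chain ⊑last , (λ i → ≤-trans x≤x∨y (≤-collapse (inner≤c i))) ,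
        (λ i → ≤-trans y≤x∨y (≤-collapse (inner≤c i))) ,
        λ V X≤V Y≤V i → collapse-least (z-least V X≤V Y≤V i) (c≤upper V X≤V Y≤V i)
        where
        open Collapse t c

        w : Fin (suc k) → Carrier
        w i = collapse (z i)

        chain : IsMultichain P (suc k) w
        chain i j i≤j = collapse-mono (⊑⇒≤ c⊑t) (z-chain i j i≤j) (z-chain j last (≤fromℕ j))

        ⊑last : ∀ i → w i ⊑ w last
        ⊑last i = subst (w i ⊑_) (sym collapse-t) (collapse-⊑ c⊑t (z i))

    mcover-lattice : ∀ k → MCoverIsLattice P (suc k)
    mcover-lattice k X Y = join X Y , meet X Y

theorem2p4 : (P : FinBoundedPoset) →
    ((m : ℕ) → m > zero → MCoverIsLattice P m)
    ⇔ (IsLatticeP P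
    × (∀ p q r → IsMeet (FinBoundedPoset._≤_ P) p q r
    → r ≡ FinBoundedPoset.bot P ⊎ r ≡ p ⊎ r ≡ q))
theorem2p4 P = mk⇔
  (λ H → let L = lattice-of-1-cover P (H 1 (s≤s z≤n)) in L , meets-trivial P L (H 2 (s≤s z≤n)))
  (λ { (L , T) (suc k) _ → mcover-lattice P L T k })
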